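{- Let $M=(E,\operatorname{rk})$ be a matroid. A subset $B\subseteq E$ is a basis of $M$ if and only if $B$ is a sink in the directed graph $G_M$.
   Context: $G_M$ is the directed graph with vertex set $2^E$ in which, for $A\subseteq E$ and $e\notin A$, there is an edge from $A$ to $A\cup\{e\}$ if $\operatorname{rk}(A)<\operatorname{rk}(A\cup\{e\})$, and otherwise an edge from $A\cup\{e\}$ to $A$; no other edges. A sink is a vertex with no outgoing edges. -}

module Defs where

open import Data.Nat using (ℕ; _≤_; _<_; _+_)
open import Data.Fin using (Fin)
open import Data.Fin.Subset using (Subset; _⊆_; _∪_; _∩_; _∈_; _∉_; ⁅_⁆; ∣_∣; _-_; ⊤)
open import Data.Product using (_×_; Σ; ∃)
open import Data.Sum using (_⊎_)
open import Relation.Nullary using (¬_)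
open import Relation.Binary.PropositionalEquality using (_≡_)

record Matroid (n : ℕ) : Set where
  field
    rk        : Subset n → ℕ
    rk-bound  : ∀ A → rk A ≤ ∣ A ∣
    rk-mono   : ∀ {A B} → A ⊆ B → rk A ≤ rk B
    rk-submod : ∀ A B → rk (A ∪ B) + rk (A ∩ B) ≤ rk A + rk B

module _ {n : ℕ} (M : Matroid n) where
  open Matroid M

  Independent : Subset n → Set
  Independent A = rk A ≡ ∣ A ∣

  IsBasis : Subset n → Set
  IsBasis B = Independent B × (∀ A → B ⊆ A → Independent A → A ≡ B)

  -- the directed graph G_M on 2^E: an edge between A and A ∪ {e} (e ∉ A)
  -- goes up iff rk A < rk (A ∪ {e}), otherwise it goes down.
  Edge : Subset n → Subset n → Set
  Edge X Y =
      (∃ λ e → e ∉ X × Y ≡ X ∪ ⁅ e ⁆ × rk X < rk (X ∪ ⁅ e ⁆))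
    ⊎ (∃ λ e → e ∉ Y × X ≡ Y ∪ ⁅ e ⁆ × ¬ (rk Y < rk (Y ∪ ⁅ e ⁆)))

  IsSink : Subset n → Set
  IsSink X = ∀ Y → ¬ Edge X Y

module Submission where

-- An edge leaves B exactly when adding some x ∉ B raises the rank or removing
-- some x ∈ B does not lower it, so B is a sink iff it is closed and every
-- removal lowers the rank.  Submodularity makes the latter property hereditary
-- to subsets of B, so by induction every subset gains one unit of rank per
-- element and B is independent; it also propagates closedness from single
-- elements to arbitrary unions, so an independent A ⊇ B has
-- |A| = rk A ≤ rk B = |B|.  Conversely a basis has no outgoing edge: an up-edge
-- would contradict maximality and a down-edge independence.

open import Defs
open import Data.Nat using (ℕ; suc; _≤_; _<_; _+_; z≤n; s≤s)
open import Data.Nat.Properties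
  using (≤-trans; ≤-antisym; ≤-reflexive; <⇒≱; ≤⇒≯; ≰⇒>; ≮⇒≥;
         +-comm; +-suc; +-mono-≤; +-monoˡ-≤; +-monoʳ-≤; +-monoˡ-<; +-cancelˡ-<; +-cancelʳ-≤;
         module ≤-Reasoning)
open import Data.Fin using (Fin; _≟_)
open import Data.Fin.Subset
  using (Subset; inside; outside; _⊆_; _⊂_; _∪_; _∩_; _─_; _-_; _∈_; _∉_; ⁅_⁆; ∣_∣; ⊥)
open import Data.Fin.Subset.Properties
  using (⊆-refl; ⊆-trans; ⊆-antisym; ∪-identityʳ; _∈?_; nonempty?; Empty-unique; ∣⊥∣≡0; ∣p∣≤∣x∷p∣; ∣⁅x⁆∣≡1;
         x∈⁅x⁆; x∈⁅y⁆⇒x≡y; x∈p∩q⁺; x∈p∪q⁺; x∈p∪q⁻; p⊆p∪q; q⊆p∪q; p─q⊆p;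
         x∈p∧x≢y⇒x∈p-y; x∈p⇒p-x⊂p; p⊆q⇒∣p∣≤∣q∣; p⊂q⇒∣p∣<∣q∣)
open import Data.Fin.Subset.Induction using (⊂-wellFounded)
open import Data.Vec using ([]; _∷_; here; there)
open import Data.Product using (_,_)
open import Data.Sum using (inj₁; inj₂; [_,_]′)
open import Function.Bundles using (_⇔_; mk⇔)
open import Induction.WellFounded using (WfRec; module All)
open import Relation.Nullary using (yes; no; contradiction)
open import Relation.Binary.PropositionalEquality using (_≡_; refl; sym; cong; subst; module ≡-Reasoning)

private
  variable
    n : ℕ
    p q r p′ q′ : Subset n
    x : Fin n

∪-⊆ : p ⊆ r → q ⊆ r → p ∪ q ⊆ r
∪-⊆ {p = p} {q = q} p⊆r q⊆r y∈p∪q = [ p⊆r , q⊆r ]′ (x∈p∪q⁻ p q y∈p∪q)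

∪-mono-⊆ : p ⊆ p′ → q ⊆ q′ → p ∪ q ⊆ p′ ∪ q′
∪-mono-⊆ {p′ = p′} {q′ = q′} p⊆p′ q⊆q′ =
  ∪-⊆ (⊆-trans p⊆p′ (p⊆p∪q q′)) (⊆-trans q⊆q′ (q⊆p∪q p′ q′))

x∈p⇒⁅x⁆⊆p : x ∈ p → ⁅ x ⁆ ⊆ p
x∈p⇒⁅x⁆⊆p {x = x} {p = p} x∈p y∈⁅x⁆ = subst (_∈ p) (sym (x∈⁅y⁆⇒x≡y x y∈⁅x⁆)) x∈p

x∈p─q⇒x∉q : x ∈ p ─ q → x ∉ q
x∈p─q⇒x∉q {p = _ ∷ _} {q = inside ∷ _} () here
x∈p─q⇒x∉q {p = _ ∷ _} {q = _ ∷ _} (there x∈p─q) (there x∈q) = x∈p─q⇒x∉q x∈p─q x∈q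

x∉p-x : x ∉ p - x
x∉p-x {x = x} x∈p-x = x∈p─q⇒x∉q x∈p-x (x∈⁅x⁆ x)

p⊆q⇒p-x⊆q-x : p ⊆ q → p - x ⊆ q - x
p⊆q⇒p-x⊆q-x {p = p} {x = x} p⊆q y∈p-x =
  x∈p∧x≢y⇒x∈p-y (p⊆q (p─q⊆p p ⁅ x ⁆ y∈p-x)) (λ { refl → x∉p-x y∈p-x })

p⊆p-x∪⁅x⁆ : p ⊆ (p - x) ∪ ⁅ x ⁆
p⊆p-x∪⁅x⁆ {x = x} {y} y∈p with y ≟ x
... | yes refl = x∈p∪q⁺ (inj₂ (x∈⁅x⁆ x))
... | no y≢x   = x∈p∪q⁺ (inj₁ (x∈p∧x≢y⇒x∈p-y y∈p y≢x))

x∈p⇒p-x∪⁅x⁆≡p : x ∈ p → (p - x) ∪ ⁅ x ⁆ ≡ p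
x∈p⇒p-x∪⁅x⁆≡p {x = x} {p = p} x∈p =
  ⊆-antisym (∪-⊆ (p─q⊆p p ⁅ x ⁆) (x∈p⇒⁅x⁆⊆p x∈p)) p⊆p-x∪⁅x⁆

∣p∪q∣≤∣p∣+∣q∣ : ∀ (p q : Subset n) → ∣ p ∪ q ∣ ≤ ∣ p ∣ + ∣ q ∣
∣p∪q∣≤∣p∣+∣q∣ []            []            = z≤n
∣p∪q∣≤∣p∣+∣q∣ (inside  ∷ p) (t       ∷ q) =
  s≤s (≤-trans (∣p∪q∣≤∣p∣+∣q∣ p q) (+-monoʳ-≤ ∣ p ∣ (∣p∣≤∣x∷p∣ t q)))
∣p∪q∣≤∣p∣+∣q∣ (outside ∷ p) (inside  ∷ q) =
  ≤-trans (s≤s (∣p∪q∣≤∣p∣+∣q∣ p q)) (≤-reflexive (sym (+-suc ∣ p ∣ ∣ q ∣)))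
∣p∪q∣≤∣p∣+∣q∣ (outside ∷ p) (outside ∷ q) = ∣p∪q∣≤∣p∣+∣q∣ p q

∣p∪⁅x⁆∣≤1+∣p∣ : ∀ (p : Subset n) x → ∣ p ∪ ⁅ x ⁆ ∣ ≤ suc ∣ p ∣
∣p∪⁅x⁆∣≤1+∣p∣ p x = ≤-trans (∣p∪q∣≤∣p∣+∣q∣ p ⁅ x ⁆) (≤-reflexive (begin
  ∣ p ∣ + ∣ ⁅ x ⁆ ∣  ≡⟨ cong (∣ p ∣ +_) (∣⁅x⁆∣≡1 x) ⟩
  ∣ p ∣ + 1          ≡⟨ +-comm ∣ p ∣ 1 ⟩
  suc ∣ p ∣          ∎))
  where open ≡-Reasoning

∣p∣≤1+∣p-x∣ : ∀ (p : Subset n) x → ∣ p ∣ ≤ suc ∣ p - x ∣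
∣p∣≤1+∣p-x∣ p x = ≤-trans (p⊆q⇒∣p∣≤∣q∣ (p⊆p-x∪⁅x⁆ {p = p} {x = x})) (∣p∪⁅x⁆∣≤1+∣p∣ (p - x) x)

p⊆q∧∣q∣≤∣p∣⇒p≡q : p ⊆ q → ∣ q ∣ ≤ ∣ p ∣ → p ≡ q
p⊆q∧∣q∣≤∣p∣⇒p≡q {p = p} p⊆q ∣q∣≤∣p∣ = ⊆-antisym p⊆q q⊆p
  where
  q⊆p : _ ⊆ p
  q⊆p {y} y∈q with y ∈? p
  ... | yes y∈p = y∈p
  ... | no  y∉p = contradiction ∣q∣≤∣p∣ (<⇒≱ (p⊂q⇒∣p∣<∣q∣ (p⊆q , y , y∈q , y∉p)))

removal-induction : (P : Subset n → Set) → P ⊥ →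
                    (∀ p x → x ∈ p → P (p - x) → P p) → ∀ p → P p
removal-induction P P⊥ P-step = All.wfRec ⊂-wellFounded _ P step
  where
  step : ∀ p → WfRec _⊂_ P p → P p
  step p rec with nonempty? p
  ... | yes (x , x∈p) = P-step p x x∈p (rec (x∈p⇒p-x⊂p x∈p))
  ... | no  p-empty   = subst P (sym (Empty-unique p-empty)) P⊥

module _ (M : Matroid n) where
  open Matroid M

  RankCritical : Subset n → Set
  RankCritical p = ∀ {x} → x ∈ p → rk (p - x) < rk p

  Closed : Subset n → Set
  Closed p = ∀ x → rk (p ∪ ⁅ x ⁆) ≤ rk p

  ∣∣≤rk⇒independent : ∣ p ∣ ≤ rk p → Independent M p
  ∣∣≤rk⇒independent {p = p} ∣p∣≤rk = ≤-antisym (rk-bound p) ∣p∣≤rk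

  rk-submod-⊆ : ∀ r → p ⊆ q → rk (q ∪ r) + rk p ≤ rk q + rk (p ∪ r)
  rk-submod-⊆ {p = p} {q = q} r p⊆q = begin
    rk (q ∪ r) + rk p                    ≤⟨ +-mono-≤ (rk-mono q∪r⊆) (rk-mono p⊆) ⟩
    rk ((p ∪ r) ∪ q) + rk ((p ∪ r) ∩ q)  ≤⟨ rk-submod (p ∪ r) q ⟩
    rk (p ∪ r) + rk q                    ≡⟨ +-comm (rk (p ∪ r)) (rk q) ⟩
    rk q + rk (p ∪ r)                    ∎
    where
    open ≤-Reasoning
    q∪r⊆ : q ∪ r ⊆ (p ∪ r) ∪ q
    q∪r⊆ = ∪-⊆ (q⊆p∪q (p ∪ r) q) (⊆-trans (q⊆p∪q p r) (p⊆p∪q q))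
    p⊆ : p ⊆ (p ∪ r) ∩ q
    p⊆ y∈p = x∈p∩q⁺ (p⊆p∪q r y∈p , p⊆q y∈p)

  rankCritical-⊆ : RankCritical q → p ⊆ q → RankCritical p
  rankCritical-⊆ {q = q} {p = p} q-critical p⊆q {x} x∈p =
    +-cancelˡ-< (rk q) (rk (p - x)) (rk p) (begin-strict
      rk q + rk (p - x)                  ≡⟨ cong (λ s → rk s + rk (p - x)) (sym (x∈p⇒p-x∪⁅x⁆≡p (p⊆q x∈p))) ⟩
      rk ((q - x) ∪ ⁅ x ⁆) + rk (p - x)  ≤⟨ rk-submod-⊆ ⁅ x ⁆ (p⊆q⇒p-x⊆q-x p⊆q) ⟩
      rk (q - x) + rk ((p - x) ∪ ⁅ x ⁆)  ≡⟨ cong (λ s → rk (q - x) + rk s) (x∈p⇒p-x∪⁅x⁆≡p x∈p) ⟩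
      rk (q - x) + rk p                  <⟨ +-monoˡ-< (rk p) (q-critical (p⊆q x∈p)) ⟩
      rk q + rk p                        ∎)
    where open ≤-Reasoning

  rankCritical⇒independent : RankCritical p → Independent M p
  rankCritical⇒independent {p = p} p-critical =
    ∣∣≤rk⇒independent (removal-induction (λ q → RankCritical q → ∣ q ∣ ≤ rk q) base step p p-critical)
    where
    open ≤-Reasoning
    base : RankCritical ⊥ → ∣ ⊥ {n} ∣ ≤ rk ⊥
    base _ = subst (_≤ rk ⊥) (sym (∣⊥∣≡0 n)) z≤n
    step : ∀ q x → x ∈ q → (RankCritical (q - x) → ∣ q - x ∣ ≤ rk (q - x)) →
           RankCritical q → ∣ q ∣ ≤ rk q
    step q x x∈q ih q-critical = begin
      ∣ q ∣             ≤⟨ ∣p∣≤1+∣p-x∣ q x ⟩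
      suc ∣ q - x ∣     ≤⟨ s≤s (ih (rankCritical-⊆ q-critical (p─q⊆p q ⁅ x ⁆))) ⟩
      suc (rk (q - x))  ≤⟨ q-critical x∈q ⟩
      rk q              ∎

  closed⇒rk-∪≤ : Closed p → ∀ q → rk (p ∪ q) ≤ rk p
  closed⇒rk-∪≤ {p = p} p-closed = removal-induction (λ q → rk (p ∪ q) ≤ rk p) base step
    where
    open ≤-Reasoning
    base : rk (p ∪ ⊥) ≤ rk p
    base = ≤-reflexive (cong rk (∪-identityʳ p))
    step : ∀ q x → x ∈ q → rk (p ∪ (q - x)) ≤ rk p → rk (p ∪ q) ≤ rk p
    step q x _ ih = +-cancelʳ-≤ (rk p) (rk (p ∪ q)) (rk p) (begin
      rk (p ∪ q) + rk p                  ≤⟨ +-monoˡ-≤ (rk p) (rk-mono p∪q⊆) ⟩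
      rk ((p ∪ (q - x)) ∪ ⁅ x ⁆) + rk p  ≤⟨ rk-submod-⊆ ⁅ x ⁆ (p⊆p∪q (q - x)) ⟩
      rk (p ∪ (q - x)) + rk (p ∪ ⁅ x ⁆)  ≤⟨ +-mono-≤ ih (p-closed x) ⟩
      rk p + rk p                        ∎)
      where
      p∪q⊆ : p ∪ q ⊆ (p ∪ (q - x)) ∪ ⁅ x ⁆
      p∪q⊆ = ∪-⊆ (⊆-trans (p⊆p∪q (q - x)) (p⊆p∪q ⁅ x ⁆))
                 (⊆-trans (p⊆p-x∪⁅x⁆ {p = q}) (∪-mono-⊆ (q⊆p∪q p (q - x)) ⊆-refl))

  closed∧independent⇒maximal : Closed p → Independent M p →
                               ∀ q → p ⊆ q → Independent M q → q ≡ p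
  closed∧independent⇒maximal {p = p} p-closed p-indep q p⊆q q-indep =
    sym (p⊆q∧∣q∣≤∣p∣⇒p≡q p⊆q (begin
      ∣ q ∣       ≡⟨ sym q-indep ⟩
      rk q        ≤⟨ rk-mono (q⊆p∪q p q) ⟩
      rk (p ∪ q)  ≤⟨ closed⇒rk-∪≤ p-closed q ⟩
      rk p        ≡⟨ p-indep ⟩
      ∣ p ∣       ∎))
    where open ≤-Reasoning

  independent∧⊂⇒rk< : Independent M q → p ⊂ q → rk p < rk q
  independent∧⊂⇒rk< {q = q} {p = p} q-indep p⊂q = begin-strict
    rk p   ≤⟨ rk-bound p ⟩
    ∣ p ∣  <⟨ p⊂q⇒∣p∣<∣q∣ p⊂q ⟩
    ∣ q ∣  ≡⟨ sym q-indep ⟩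
    rk q   ∎
    where open ≤-Reasoning

  independent-∪⁅⁆ : Independent M p → rk p < rk (p ∪ ⁅ x ⁆) → Independent M (p ∪ ⁅ x ⁆)
  independent-∪⁅⁆ {p = p} {x = x} p-indep rk< = ∣∣≤rk⇒independent (begin
    ∣ p ∪ ⁅ x ⁆ ∣   ≤⟨ ∣p∪⁅x⁆∣≤1+∣p∣ p x ⟩
    suc ∣ p ∣       ≡⟨ cong suc (sym p-indep) ⟩
    suc (rk p)      ≤⟨ rk< ⟩
    rk (p ∪ ⁅ x ⁆)  ∎)
    where open ≤-Reasoning

  basis⇒sink : IsBasis M p → IsSink M p
  basis⇒sink (p-indep , p-maximal) _ (inj₁ (x , x∉p , refl , rk<)) =
    x∉p (subst (x ∈_) (p-maximal _ (p⊆p∪q ⁅ x ⁆) (independent-∪⁅⁆ p-indep rk<))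
                      (x∈p∪q⁺ (inj₂ (x∈⁅x⁆ x))))
  basis⇒sink (p-indep , _) q (inj₂ (x , x∉q , refl , rk≮)) =
    rk≮ (independent∧⊂⇒rk< p-indep (p⊆p∪q ⁅ x ⁆ , x , x∈p∪q⁺ (inj₂ (x∈⁅x⁆ x)) , x∉q))

  sink⇒rankCritical : IsSink M p → RankCritical p
  sink⇒rankCritical {p = p} p-sink {x} x∈p = ≰⇒> λ rk≤ →
    p-sink (p - x) (inj₂ (x , x∉p-x , sym p-x∪⁅x⁆≡p ,
                         ≤⇒≯ (subst (λ s → rk s ≤ rk (p - x)) (sym p-x∪⁅x⁆≡p) rk≤)))
    where
    p-x∪⁅x⁆≡p : (p - x) ∪ ⁅ x ⁆ ≡ p
    p-x∪⁅x⁆≡p = x∈p⇒p-x∪⁅x⁆≡p x∈p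

  sink⇒closed : IsSink M p → Closed p
  sink⇒closed {p = p} p-sink x with x ∈? p
  ... | yes x∈p = rk-mono (∪-⊆ ⊆-refl (x∈p⇒⁅x⁆⊆p x∈p))
  ... | no  x∉p = ≮⇒≥ λ rk< → p-sink (p ∪ ⁅ x ⁆) (inj₁ (x , x∉p , refl , rk<))

  sink⇒basis : IsSink M p → IsBasis M p
  sink⇒basis {p = p} p-sink = p-indep , closed∧independent⇒maximal (sink⇒closed p-sink) p-indep
    where
    p-indep : Independent M p
    p-indep = rankCritical⇒independent (sink⇒rankCritical p-sink)

lemma22 : ∀ {n : ℕ} (M : Matroid n) (B : Subset n) → IsBasis M B ⇔ IsSink M B
lemma22 M B = mk⇔ (basis⇒sink M) (sink⇒basis M)
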